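{- We have $\theta(1)=1$ and $\theta(2)=2$. Moreover, the inequality $\theta(n) \geqslant 2^{2^{n-2}}$ holds for every integer $n \geqslant 3$.
   Context: For a positive integer $n$, let $E_n=\{x_i \cdot x_j=x_k,\ x_i+1=x_k:\ i,j,k \in \{1,\ldots,n\}\}$, a set of equations in the variables $x_1,\ldots,x_n$. Let $\theta(n)$ denote the smallest positive integer $b$ such that for each system $S \subseteq E_n$ which has a solution in positive integers $x_1,\ldots,x_n$ and which has only finitely many solutions in positive integers $x_1,\ldots,x_n$, there exists a solution of $S$ in $([1,b] \cap \mathbb{N})^n$. -}

module Defs where

open import Data.Nat using (ℕ; _+_; _*_; _≤_)
open import Data.Fin using (Fin)
open import Data.Vec using (Vec; lookup)
open import Data.Vec.Relation.Unary.All as VAll using ()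
open import Data.List using (List)
open import Data.List.Relation.Unary.All using (All)
open import Data.List.Membership.Propositional using (_∈_)
open import Data.Product using (Σ; _×_)
open import Relation.Binary.PropositionalEquality using (_≡_)

-- An element of E_n: either x_i · x_j = x_k or x_i + 1 = x_k, with i,j,k ∈ {1..n}
-- (indices represented by Fin n).
data Equation (n : ℕ) : Set where
  mul : Fin n → Fin n → Fin n → Equation n
  suc1 : Fin n → Fin n → Equation n

System : ℕ → Set
System n = List (Equation n)

Satisfies : ∀ {n} → Vec ℕ n → Equation n → Set
Satisfies x (mul i j k) = lookup x i * lookup x j ≡ lookup x k
Satisfies x (suc1 i k) = lookup x i + 1 ≡ lookup x k

IsSolution : ∀ {n} → System n → Vec ℕ n → Set
IsSolution S x = VAll.All (1 ≤_) x × All (Satisfies x) S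

HasSolution : ∀ {n} → System n → Set
HasSolution {n} S = Σ (Vec ℕ n) (IsSolution S)

FinitelyManySolutions : ∀ {n} → System n → Set
FinitelyManySolutions {n} S =
  Σ (List (Vec ℕ n)) λ L → ∀ x → IsSolution S x → x ∈ L

Good : ℕ → ℕ → Set
Good n b = ∀ (S : System n) → HasSolution S → FinitelyManySolutions S →
  Σ (Vec ℕ n) λ x → IsSolution S x × VAll.All (_≤ b) x

IsTheta : ℕ → ℕ → Set
IsTheta n t = 1 ≤ t × Good n t × (∀ b → 1 ≤ b → Good n b → t ≤ b)

-- A solution of a system over one or two variables either satisfies no
-- successor equation, and then the all-ones vector solves the system too, or
-- it is (a, a + 1) up to order.  For a ≥ 2 the product
-- equations then all fail, while the successor equations that hold do not see
-- a, so (c, c + 1) is a solution for every c and the system has infinitely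
-- many solutions; hence a = 1 and the solution lies in [1, 2]².
--
-- The lower bound comes from the system x₀ · x₀ = x₀, x₀ + 1 = x₁,
-- xᵢ₊₁ · xᵢ₊₁ = xᵢ₊₂, whose only solution is xᵢ₊₁ = 2 ^ 2 ^ i.
module Submission where

open import Defs
open import Data.Nat using (ℕ; zero; suc; _+_; _*_; _≤_; _<_; _^_; _∸_; z≤n; s≤s; >-nonZero)
open import Data.Nat.Properties
open import Data.Fin using (Fin; zero; suc; toℕ; inject₁; fromℕ)
open import Data.Fin.Properties using (toℕ-inject₁; toℕ-fromℕ)
open import Data.Fin.Induction using (<-weakInduction)
open import Data.Vec using (Vec; []; _∷_; lookup; tabulate; replicate)
open import Data.Vec.Properties using (lookup∘tabulate; lookup-replicate)
open import Data.Vec.Relation.Unary.All as VAll using ()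
open import Data.Vec.Relation.Unary.All.Properties using (lookup⁺; lookup⁻)
open import Data.Vec.Relation.Binary.Pointwise.Extensional using (ext; Pointwise-≡⇒≡)
import Data.List as List
open import Data.List using ([]; _∷_)
open import Data.List.Relation.Unary.All as LAll using (All; _∷_)
open import Data.List.Relation.Unary.All.Properties using (tabulate⁺; tabulate⁻)
open import Data.List.Relation.Unary.Any using (here)
open import Data.List.Membership.Propositional.Properties using (∈-map⁺)
open import Data.List.Extrema.Nat using (max; xs≤max)
open import Data.Product using (Σ; _×_; _,_)
open import Data.Empty using (⊥-elim)
open import Relation.Nullary using (¬_; yes; no)
open import Relation.Binary.PropositionalEquality

SolutionWithin : ∀ {n} → System n → ℕ → Set
SolutionWithin {n} S b = Σ (Vec ℕ n) λ x → IsSolution S x × VAll.All (_≤ b) x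

m+1<u*v : ∀ {m u v} → 2 ≤ m → m ≤ u → m ≤ v → m + 1 < u * v
m+1<u*v {m} {u} {v} 2≤m m≤u m≤v = begin-strict
  m + 1  <⟨ +-monoʳ-< m 2≤m ⟩
  m + m  ≡⟨ cong (m +_) (sym (+-identityʳ m)) ⟩
  2 * m  ≤⟨ *-mono-≤ 2≤m ≤-refl ⟩
  m * m  ≤⟨ *-mono-≤ m≤u m≤v ⟩
  u * v  ∎
  where open ≤-Reasoning

*-idem⇒≡1 : ∀ {a} → 1 ≤ a → a * a ≡ a → a ≡ 1
*-idem⇒≡1 {a} 1≤a a*a≡a = *-cancelʳ-≡ a 1 a {{>-nonZero 1≤a}} (trans a*a≡a (sym (*-identityˡ a)))

unbounded⇒¬finite : ∀ {n} {S : System n} (μ : Vec ℕ n → ℕ) →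
  (∀ c → Σ (Vec ℕ n) λ x → IsSolution S x × c ≤ μ x) → ¬ FinitelyManySolutions S
unbounded⇒¬finite μ unbounded (L , complete)
  with unbounded (suc (max 0 (List.map μ L)))
... | x , sol , c≤μx = 1+n≰n (≤-trans c≤μx μx≤max)
  where
  μx≤max : μ x ≤ max 0 (List.map μ L)
  μx≤max = LAll.lookup (xs≤max 0 (List.map μ L)) (∈-map⁺ μ (complete x sol))

NoSuccessor : ∀ {n} → Vec ℕ n → Set
NoSuccessor {n} x = ∀ (i k : Fin n) → lookup x i + 1 ≢ lookup x k

ones-satisfies : ∀ {n} {x : Vec ℕ n} → NoSuccessor x →
  ∀ e → Satisfies x e → Satisfies (replicate n 1) e
ones-satisfies _ (mul i j k) _
  rewrite lookup-replicate i 1 | lookup-replicate j 1 | lookup-replicate k 1 = refl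
ones-satisfies noSucc (suc1 i k) eq = ⊥-elim (noSucc i k eq)

noSuccessor⇒within : ∀ {n} {S : System n} {x : Vec ℕ n} b → 1 ≤ b →
  NoSuccessor x → All (Satisfies x) S → SolutionWithin S b
noSuccessor⇒within {n} b 1≤b noSucc sat =
  replicate n 1 ,
  (lookup⁻ (λ i → ≤-reflexive (sym (lookup-replicate i 1))) ,
   LAll.map (ones-satisfies noSucc _) sat) ,
  lookup⁻ (λ i → subst (_≤ b) (sym (lookup-replicate i 1)) 1≤b)

shift : ∀ {n} → (Fin n → ℕ) → ℕ → Vec ℕ n
shift δ c = tabulate (λ i → δ i + c)

module _ {n : ℕ} (δ : Fin n → ℕ) where

  lookup-shift : ∀ c i → lookup (shift δ c) i ≡ δ i + c
  lookup-shift c = lookup∘tabulate (λ i → δ i + c)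

  shift-positive : ∀ {c} → 1 ≤ c → VAll.All (1 ≤_) (shift δ c)
  shift-positive {c} 1≤c =
    lookup⁻ (λ i → subst (1 ≤_) (sym (lookup-shift c i)) (≤-trans 1≤c (m≤n+m c (δ i))))

  shift-suc1 : ∀ a c i k → Satisfies (shift δ a) (suc1 i k) → Satisfies (shift δ c) (suc1 i k)
  shift-suc1 a c i k eq = begin
    lookup (shift δ c) i + 1  ≡⟨ cong (_+ 1) (lookup-shift c i) ⟩
    δ i + c + 1              ≡⟨ +-comm (δ i + c) 1 ⟩
    suc (δ i) + c            ≡⟨ cong (_+ c) offsets ⟩
    δ k + c                  ≡⟨ lookup-shift c k ⟨
    lookup (shift δ c) k     ∎
    where
    open ≡-Reasoning
    offsets : suc (δ i) ≡ δ k
    offsets = +-cancelʳ-≡ a (suc (δ i)) (δ k) (begin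
      suc (δ i) + a            ≡⟨ +-comm 1 (δ i + a) ⟩
      δ i + a + 1              ≡⟨ cong (_+ 1) (lookup-shift a i) ⟨
      lookup (shift δ a) i + 1 ≡⟨ eq ⟩
      lookup (shift δ a) k     ≡⟨ lookup-shift a k ⟩
      δ k + a                  ∎)

  module _ (δ≤1 : ∀ i → δ i ≤ 1) where

    shift-refutes-mul : ∀ {a} → 2 ≤ a → ∀ i j k → ¬ Satisfies (shift δ a) (mul i j k)
    shift-refutes-mul {a} 2≤a i j k eq = <⇒≱ (m+1<u*v 2≤a (lower i) (lower j)) (begin
      lookup (shift δ a) i * lookup (shift δ a) j ≡⟨ eq ⟩
      lookup (shift δ a) k                        ≡⟨ lookup-shift a k ⟩
      δ k + a                                     ≤⟨ +-monoˡ-≤ a (δ≤1 k) ⟩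
      1 + a                                       ≡⟨ +-comm 1 a ⟩
      a + 1                                       ∎)
      where
      open ≤-Reasoning
      lower : ∀ i → a ≤ lookup (shift δ a) i
      lower i = subst (a ≤_) (sym (lookup-shift a i)) (m≤n+m a (δ i))

    shift-satisfies : ∀ {a} → 2 ≤ a → ∀ c e → Satisfies (shift δ a) e → Satisfies (shift δ c) e
    shift-satisfies 2≤a c (mul i j k) eq = ⊥-elim (shift-refutes-mul 2≤a i j k eq)
    shift-satisfies {a} 2≤a c (suc1 i k) eq = shift-suc1 a c i k eq

shift-solution⇒within-2 : ∀ {n} {S : System (suc n)} (δ : Fin (suc n) → ℕ) →
  (∀ i → δ i ≤ 1) → ∀ {a} → 1 ≤ a → All (Satisfies (shift δ a)) S →
  FinitelyManySolutions S → SolutionWithin S 2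
shift-solution⇒within-2 δ δ≤1 {suc zero} 1≤a sat _ =
  shift δ 1 , (shift-positive δ 1≤a , sat) ,
  lookup⁻ (λ i → subst (_≤ 2) (sym (lookup-shift δ 1 i)) (+-monoˡ-≤ 1 (δ≤1 i)))
shift-solution⇒within-2 {n} {S} δ δ≤1 {suc (suc a)} _ sat finite =
  ⊥-elim (unbounded⇒¬finite (λ x → lookup x zero) solutions finite)
  where
  solutions : ∀ c → Σ (Vec ℕ (suc n)) λ x → IsSolution S x × c ≤ lookup x zero
  solutions c =
    shift δ (suc c) ,
    (shift-positive δ (s≤s z≤n) ,
     LAll.map (shift-satisfies δ δ≤1 (s≤s (s≤s z≤n)) (suc c) _) sat) ,
    subst (c ≤_) (sym (lookup-shift δ (suc c) zero)) (≤-trans (n≤1+n c) (m≤n+m (suc c) (δ zero)))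

good-1-1 : Good 1 1
good-1-1 S ((a ∷ []) , _ , sat) _ = noSuccessor⇒within 1 ≤-refl noSuccessor sat
  where
  noSuccessor : NoSuccessor (a ∷ [])
  noSuccessor zero zero = m+1+n≢m a

good-2-2 : Good 2 2
good-2-2 S ((a ∷ b ∷ []) , (1≤a VAll.∷ 1≤b VAll.∷ VAll.[]) , sat) finite
  with suc a ≟ b | suc b ≟ a
... | yes refl | _ = shift-solution⇒within-2 lowFirst (λ { zero → z≤n ; (suc zero) → ≤-refl }) 1≤a sat finite
  where
  lowFirst : Fin 2 → ℕ
  lowFirst zero = 0
  lowFirst (suc zero) = 1
... | no _ | yes refl = shift-solution⇒within-2 lowSecond (λ { zero → ≤-refl ; (suc zero) → z≤n }) 1≤b sat finite
  where
  lowSecond : Fin 2 → ℕ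
  lowSecond zero = 1
  lowSecond (suc zero) = 0
... | no a+1≢b | no b+1≢a = noSuccessor⇒within 2 (s≤s z≤n) noSuccessor sat
  where
  noSuccessor : NoSuccessor (a ∷ b ∷ [])
  noSuccessor zero zero = m+1+n≢m a
  noSuccessor zero (suc zero) eq = a+1≢b (trans (+-comm 1 a) eq)
  noSuccessor (suc zero) zero eq = b+1≢a (trans (+-comm 1 b) eq)
  noSuccessor (suc zero) (suc zero) = m+1+n≢m b

tower : ℕ → ℕ
tower k = 2 ^ 2 ^ k

tower-suc : ∀ k → tower k * tower k ≡ tower (suc k)
tower-suc k = begin
  2 ^ 2 ^ k * 2 ^ 2 ^ k  ≡⟨ ^-distribˡ-+-* 2 (2 ^ k) (2 ^ k) ⟨
  2 ^ (2 ^ k + 2 ^ k)    ≡⟨ cong (λ e → 2 ^ (2 ^ k + e)) (+-identityʳ (2 ^ k)) ⟨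
  2 ^ 2 ^ suc k          ∎
  where open ≡-Reasoning

squaringStep : ∀ m → Fin m → Equation (2 + m)
squaringStep m i = mul (suc (inject₁ i)) (suc (inject₁ i)) (suc (suc i))

squaringChain : ∀ m → System (2 + m)
squaringChain m = mul zero zero zero ∷ suc1 zero (suc zero) ∷ List.tabulate (squaringStep m)

towers : ∀ m → Vec ℕ (2 + m)
towers m = 1 ∷ tabulate (λ j → tower (toℕ j))

lookup-towers : ∀ m (j : Fin (suc m)) → lookup (towers m) (suc j) ≡ tower (toℕ j)
lookup-towers m = lookup∘tabulate (λ j → tower (toℕ j))

towers-solves : ∀ m → IsSolution (squaringChain m) (towers m)
towers-solves m = positive , refl ∷ sym (lookup-towers m zero) ∷ tabulate⁺ step
  where
  positive : VAll.All (1 ≤_) (towers m)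
  positive = s≤s z≤n VAll.∷ lookup⁻ (λ j → subst (1 ≤_) (sym (lookup-towers m j)) (m^n>0 2 (2 ^ toℕ j)))
  step : ∀ i → Satisfies (towers m) (squaringStep m i)
  step i rewrite lookup-towers m (inject₁ i) | lookup-towers m (suc i) | toℕ-inject₁ i = tower-suc (toℕ i)

squaringChain-unique : ∀ m {x} → IsSolution (squaringChain m) x → x ≡ towers m
squaringChain-unique m {x₀ ∷ xs} ((1≤x₀ VAll.∷ _) , x₀²≡x₀ ∷ x₀+1≡x₁ ∷ steps) =
  Pointwise-≡⇒≡ (ext λ { zero → x₀≡1 ; (suc j) → trans (chain j) (sym (lookup-towers m j)) })
  where
  open ≡-Reasoning
  x = x₀ ∷ xs
  x₀≡1 : x₀ ≡ 1
  x₀≡1 = *-idem⇒≡1 1≤x₀ x₀²≡x₀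
  chain : ∀ j → lookup x (suc j) ≡ tower (toℕ j)
  chain = <-weakInduction (λ j → lookup x (suc j) ≡ tower (toℕ j))
    (trans (sym x₀+1≡x₁) (cong (_+ 1) x₀≡1))
    λ i ih → begin
      lookup x (suc (suc i))                            ≡⟨ tabulate⁻ steps i ⟨
      lookup x (suc (inject₁ i)) * lookup x (suc (inject₁ i)) ≡⟨ cong₂ _*_ ih ih ⟩
      tower (toℕ (inject₁ i)) * tower (toℕ (inject₁ i)) ≡⟨ cong (λ k → tower k * tower k) (toℕ-inject₁ i) ⟩
      tower (toℕ i) * tower (toℕ i)                     ≡⟨ tower-suc (toℕ i) ⟩
      tower (suc (toℕ i))                               ∎

good⇒tower≤ : ∀ m {b} → Good (2 + m) b → tower m ≤ b
good⇒tower≤ m {b} good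
  with good (squaringChain m) (towers m , towers-solves m) ((towers m ∷ []) , λ _ sol → here (squaringChain-unique m sol))
... | x , sol , x≤b = subst (_≤ b) x[last]≡tower (lookup⁺ x≤b (suc (fromℕ m)))
  where
  x[last]≡tower : lookup x (suc (fromℕ m)) ≡ tower m
  x[last]≡tower = begin
    lookup x (suc (fromℕ m))           ≡⟨ cong (λ v → lookup v (suc (fromℕ m))) (squaringChain-unique m sol) ⟩
    lookup (towers m) (suc (fromℕ m))  ≡⟨ lookup-towers m (fromℕ m) ⟩
    tower (toℕ (fromℕ m))              ≡⟨ cong tower (toℕ-fromℕ m) ⟩
    tower m                            ∎
    where open ≡-Reasoning

theorem1 : IsTheta 1 1 × IsTheta 2 2 ×
    (∀ n → 3 ≤ n → ∀ b → 1 ≤ b → Good n b → 2 ^ (2 ^ (n ∸ 2)) ≤ b)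
theorem1 =
  (≤-refl , good-1-1 , λ _ 1≤b _ → 1≤b) ,
  (s≤s z≤n , good-2-2 , λ _ _ good → good⇒tower≤ 0 good) ,
  λ { (suc (suc (suc k))) _ _ _ good → good⇒tower≤ (suc k) good
    ; (suc zero) (s≤s ())
    ; (suc (suc zero)) (s≤s (s≤s ())) }
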